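{- Let $n\ge 1$. Every equivalence class of the equivalence relation $\sim$ on the symmetric group $\mathfrak{S}_n$ contains exactly one salient permutation.
   Context: Permutations $w\in\mathfrak{S}_n$ are regarded as words $a_1a_2\cdots a_n$. Two permutations $u,v\in\mathfrak{S}_n$ are equivalent, $u\sim v$, if $v$ can be obtained from $u$ by a sequence of interchanges of two adjacent entries $a_i,a_{i+1}$ satisfying $|a_i-a_{i+1}|=1$. A permutation $w=a_1a_2\cdots a_n$ is called salient if there is no $i$ ($1\le i\le n-1$) with $a_i=a_{i+1}+1$, and no $i$ ($1\le i\le n-2$) with $a_i=a_{i+1}+2=a_{i+2}+1$. -}

module Defs where

open import Data.Nat using (ℕ; suc; _+_)
open import Data.List using (List; []; _∷_; _++_; upTo; map)
open import Data.List.Relation.Binary.Permutation.Propositional using (_↭_)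
open import Relation.Binary.PropositionalEquality using (_≡_)
open import Relation.Binary.Construct.Closure.ReflexiveTransitive using (Star)
open import Data.Product using (_×_; Σ; ∃; _,_)
open import Data.Sum using (_⊎_)
open import Relation.Nullary using (¬_)

oneToN : ℕ → List ℕ
oneToN n = map suc (upTo n)

IsPerm : ℕ → List ℕ → Set
IsPerm n w = w ↭ oneToN n

AdjValues : ℕ → ℕ → Set
AdjValues a b = (a ≡ suc b) ⊎ (b ≡ suc a)

data Step : List ℕ → List ℕ → Set where
  swap : ∀ (xs ys : List ℕ) (a b : ℕ) → AdjValues a b →
         Step (xs ++ a ∷ b ∷ ys) (xs ++ b ∷ a ∷ ys)

_∼_ : List ℕ → List ℕ → Set
u ∼ v = Star Step u v

Salient : List ℕ → Set
Salient w = (¬ ∃ λ (xs : List ℕ) → ∃ λ (ys : List ℕ) → ∃ λ (a : ℕ) → ∃ λ (b : ℕ) →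
               (w ≡ xs ++ a ∷ b ∷ ys) × (a ≡ b + 1))
          × (¬ ∃ λ (xs : List ℕ) → ∃ λ (ys : List ℕ) → ∃ λ (a : ℕ) → ∃ λ (b : ℕ) → ∃ λ (c : ℕ) →
               (w ≡ xs ++ a ∷ b ∷ c ∷ ys) × (a ≡ b + 2) × (b + 2 ≡ c + 1))

-- Rewriting a word by the moves (k+1)k → k(k+1) and (k+2)k(k+1) → (k+1)(k+2)k,
-- each realised by swaps of values differing by 1, strictly lowers the potential
-- Σ (number of entries to the right of a) · a², so every word reaches a salient
-- one.  Conversely a swap never exchanges two values at distance ≥ 2, so the
-- relative order of every such pair is an invariant of the class; inspecting
-- the first entries shows that two salient permutations with the same invariant
-- coincide.
module Submission where

open import Defs
open import Relation.Binary.PropositionalEquality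
  using (_≡_; _≢_; refl; sym; trans; cong; cong₂; subst; setoid; module ≡-Reasoning)
open import Data.Nat using (ℕ; suc; _+_; _*_; _<_; _≥_; z<s)
open import Data.Nat.Properties
  using (_≟_; suc-injective; +-comm; +-suc; 1+n≢n; +-monoʳ-<; m<m+n)
open import Data.Nat.Induction using (<-wellFounded)
open import Data.Nat.Tactic.RingSolver using (solve-∀)
open import Data.List using (List; []; _∷_; _++_; length; filter)
open import Data.List.Properties
  using (∷-injective; filter-accept; filter-reject; filter-++; filter-none)
open import Data.List.Membership.Propositional using (_∈_)
open import Data.List.Relation.Unary.All using (All; []; _∷_)
open import Data.List.Relation.Unary.AllPairs using (_∷_)
import Data.List.Relation.Unary.AllPairs as AllPairs
open import Data.List.Relation.Unary.Any using (here)
import Data.List.Relation.Unary.Any as Any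
open import Data.List.Relation.Unary.Unique.Propositional using (Unique)
import Data.List.Relation.Unary.Unique.Propositional.Properties as Unique
open import Data.List.Relation.Binary.Permutation.Propositional
  using (_↭_; ↭-refl; ↭-sym; ↭-trans; ↭-swap; ↭⇒↭ₛ)
open import Data.List.Relation.Binary.Permutation.Propositional.Properties
  using (++⁺ˡ; drop-∷; ∈-resp-↭; ↭-length; ¬x∷xs↭[])
open import Data.List.Relation.Binary.Permutation.Setoid.Properties (setoid ℕ)
  using (Unique-resp-↭)
open import Data.Product using (_×_; ∃; _,_; proj₁; proj₂)
open import Data.Sum using (_⊎_; inj₁; inj₂; [_,_])
import Data.Sum as Sum
open import Data.Empty using (⊥-elim)
open import Function using (_∘_; case_of_)
open import Induction.WellFounded using (Acc; acc)
open import Level using (Level)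
open import Relation.Binary.Construct.Closure.ReflexiveTransitive
  using (ε; _◅_; _◅◅_; gmap; fold)
open import Relation.Nullary using (¬_; Dec; yes; no)
open import Relation.Nullary.Decidable using (_⊎-dec_)
open import Relation.Unary using (Pred; Decidable)

module _ {a p : Level} {A : Set a} {P : Pred A p} (P? : Decidable P) where

  filter-∷-cong : ∀ x {xs ys} → filter P? xs ≡ filter P? ys →
                  filter P? (x ∷ xs) ≡ filter P? (x ∷ ys)
  filter-∷-cong x eq with P? x
  ... | yes _ = cong (x ∷_) eq
  ... | no _  = eq

  filter-swap-rejected : ∀ {x y} zs → ¬ P y → filter P? (x ∷ y ∷ zs) ≡ filter P? (y ∷ x ∷ zs)
  filter-swap-rejected {x} zs ¬py =
    trans (filter-∷-cong x (filter-reject P? ¬py)) (sym (filter-reject P? ¬py))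

  filter-swap : ∀ {x y} zs → ¬ (P x × P y) → filter P? (x ∷ y ∷ zs) ≡ filter P? (y ∷ x ∷ zs)
  filter-swap {y = y} zs ¬both = case P? y of λ where
    (no ¬py) → filter-swap-rejected zs ¬py
    (yes py) → sym (filter-swap-rejected zs (λ px → ¬both (px , py)))

  filter-∷-cancel : ∀ x {xs ys} → filter P? (x ∷ xs) ≡ filter P? (x ∷ ys) →
                    filter P? xs ≡ filter P? ys
  filter-∷-cancel x eq with P? x
  ... | yes _ = proj₂ (∷-injective eq)
  ... | no _  = eq

∷-step : ∀ x {u v} → Step u v → Step (x ∷ u) (x ∷ v)
∷-step x (swap xs ys a b adj) = swap (x ∷ xs) ys a b adj

∷-∼ : ∀ x {u v} → u ∼ v → (x ∷ u) ∼ (x ∷ v)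
∷-∼ x = gmap (x ∷_) (∷-step x)

step⇒↭ : ∀ {u v} → Step u v → u ↭ v
step⇒↭ (swap xs ys a b _) = ++⁺ˡ xs (↭-swap a b ↭-refl)

∼⇒↭ : ∀ {u v} → u ∼ v → u ↭ v
∼⇒↭ = fold _↭_ (↭-trans ∘ step⇒↭) ↭-refl

-- An occurrence of a factor forbidden in salient words (¬ Redex ⇔ Salient below),
-- indexed so that it can be found and rewritten by recursion on the word.
data Redex : List ℕ → Set where
  descent : ∀ {k ys} → Redex (suc k ∷ k ∷ ys)
  hook    : ∀ {k ys} → Redex (suc (suc k) ∷ k ∷ suc k ∷ ys)
  later   : ∀ {x w} → Redex w → Redex (x ∷ w)

redex-++ : ∀ xs {w} → Redex w → Redex (xs ++ w)
redex-++ []       r = r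
redex-++ (x ∷ xs) r = later (redex-++ xs r)

redex-∷? : ∀ x {w} → ¬ Redex w → Dec (Redex (x ∷ w))
redex-∷? x {[]} ¬r = no λ { (later ()) }
redex-∷? x {y ∷ w} ¬r with x ≟ suc y
... | yes refl = yes descent
redex-∷? x {y ∷ []} ¬r | no x≢1+y =
  no λ { descent → x≢1+y refl ; (later r) → ¬r r }
redex-∷? x {y ∷ z ∷ w} ¬r | no x≢1+y with x ≟ suc (suc y) | z ≟ suc y
... | yes refl | yes refl = yes hook
... | yes refl | no z≢1+y =
  no λ { hook → z≢1+y refl ; (later r) → ¬r r }
... | no x≢2+y | _ =
  no λ { descent → x≢1+y refl ; hook → x≢2+y refl ; (later r) → ¬r r }

redex? : Decidable Redex
redex? []      = no λ ()
redex? (x ∷ w) with redex? w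
... | yes r  = yes (later r)
... | no ¬r  = redex-∷? x ¬r

salient-tail : ∀ {x w} → Salient (x ∷ w) → Salient w
salient-tail {x} (no-descent , no-hook) =
    (λ (xs , ys , a , b , e , a≡) → no-descent (x ∷ xs , ys , a , b , cong (x ∷_) e , a≡))
  , (λ (xs , ys , a , b , c , e , a≡ , b≡) →
       no-hook (x ∷ xs , ys , a , b , c , cong (x ∷_) e , a≡ , b≡))

salient⇒¬redex : ∀ {w} → Salient w → ¬ Redex w
salient⇒¬redex (no-descent , _) (descent {k} {ys}) =
  no-descent ([] , ys , suc k , k , refl , sym (+-comm k 1))
salient⇒¬redex (_ , no-hook) (hook {k} {ys}) =
  no-hook ([] , ys , suc (suc k) , k , suc k , refl , sym (+-comm k 2) , +-suc k 1)
salient⇒¬redex sal (later r) = salient⇒¬redex (salient-tail sal) r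

¬redex⇒salient : ∀ {w} → ¬ Redex w → Salient w
¬redex⇒salient ¬r =
    (λ { (xs , ys , a , b , refl , a≡) → ¬r (redex-++ xs (descent-at a≡)) })
  , (λ { (xs , ys , a , b , c , refl , a≡ , b≡) → ¬r (redex-++ xs (hook-at a≡ b≡)) })
  where
  descent-at : ∀ {a b ys} → a ≡ b + 1 → Redex (a ∷ b ∷ ys)
  descent-at {b = b} refl rewrite +-comm b 1 = descent

  hook-at : ∀ {a b c ys} → a ≡ b + 2 → b + 2 ≡ c + 1 → Redex (a ∷ b ∷ c ∷ ys)
  hook-at {b = b} {c} refl b+2≡c+1
    with suc-injective (trans (sym (+-comm b 2)) (trans b+2≡c+1 (+-comm c 1)))
  ... | refl rewrite +-comm b 2 = hook

potential : List ℕ → ℕ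
potential []      = 0
potential (a ∷ w) = length w * (a * a) + potential w

potential-∷-< : ∀ x {u v} → length u ≡ length v → potential u < potential v →
                potential (x ∷ u) < potential (x ∷ v)
potential-∷-< x {v = v} eq lt rewrite eq = +-monoʳ-< (length v * (x * x)) lt

descent-lowers-potential : ∀ k ys → potential (k ∷ suc k ∷ ys) < potential (suc k ∷ k ∷ ys)
descent-lowers-potential k ys =
  subst (potential (k ∷ suc k ∷ ys) <_) (gap (length ys) k (potential ys)) (m<m+n _ z<s)
  where
  gap : ∀ L k r → (1 + L) * (k * k) + (L * ((1 + k) * (1 + k)) + r) + (1 + (k + k))
                ≡ (1 + L) * ((1 + k) * (1 + k)) + (L * (k * k) + r)
  gap = solve-∀

hook-lowers-potential : ∀ k ys →
  potential (suc k ∷ suc (suc k) ∷ k ∷ ys) < potential (suc (suc k) ∷ k ∷ suc k ∷ ys)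
hook-lowers-potential k ys =
  subst (potential (suc k ∷ suc (suc k) ∷ k ∷ ys) <_) (gap (length ys) k (potential ys))
        (m<m+n _ z<s)
  where
  gap : ∀ L k r →
        (2 + L) * ((1 + k) * (1 + k)) + ((1 + L) * ((2 + k) * (2 + k)) + (L * (k * k) + r)) + 2
      ≡ (2 + L) * ((2 + k) * (2 + k)) + ((1 + L) * (k * k) + (L * ((1 + k) * (1 + k)) + r))
  gap = solve-∀

reduce : ∀ {w} → Redex w → ∃ λ w′ → w ∼ w′ × potential w′ < potential w
reduce (descent {k} {ys}) =
  k ∷ suc k ∷ ys , swap [] ys (suc k) k (inj₁ refl) ◅ ε , descent-lowers-potential k ys
reduce (hook {k} {ys}) =
  suc k ∷ suc (suc k) ∷ k ∷ ys ,
  swap (suc (suc k) ∷ []) ys k (suc k) (inj₂ refl) ◅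
  swap [] (k ∷ ys) (suc (suc k)) (suc k) (inj₁ refl) ◅ ε ,
  hook-lowers-potential k ys
reduce (later {x} {w} r) with reduce r
... | w′ , w∼w′ , lt =
  x ∷ w′ , ∷-∼ x w∼w′ , potential-∷-< x {w′} {w} (↭-length (↭-sym (∼⇒↭ w∼w′))) lt

normalise : ∀ w → Acc _<_ (potential w) → ∃ λ s → w ∼ s × ¬ Redex s
normalise w (acc rs) with redex? w
... | no ¬r = w , ε , ¬r
... | yes r with reduce r
...   | w′ , w∼w′ , lt with normalise w′ (rs lt)
...     | s , w′∼s , ¬rs = s , w∼w′ ◅◅ w′∼s , ¬rs

Far : ℕ → ℕ → Set
Far x y = x ≢ y × ¬ AdjValues x y

OneOf : ℕ → ℕ → ℕ → Set
OneOf x y z = z ≡ x ⊎ z ≡ y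

oneOf? : ∀ x y → Decidable (OneOf x y)
oneOf? x y z = (z ≟ x) ⊎-dec (z ≟ y)

restrict : ℕ → ℕ → List ℕ → List ℕ
restrict x y = filter (oneOf? x y)

Agree : List ℕ → List ℕ → Set
Agree u v = ∀ x y → Far x y → restrict x y u ≡ restrict x y v

agree-sym : ∀ {u v} → Agree u v → Agree v u
agree-sym ag x y f = sym (ag x y f)

agree-trans : ∀ {u v w} → Agree u v → Agree v w → Agree u w
agree-trans ag ag′ x y f = trans (ag x y f) (ag′ x y f)

agree-∷-cancel : ∀ {m u v} → Agree (m ∷ u) (m ∷ v) → Agree u v
agree-∷-cancel {m} ag x y f = filter-∷-cancel (oneOf? x y) m (ag x y f)

adj-irrefl : ∀ {a} → ¬ AdjValues a a
adj-irrefl (inj₁ a≡1+a) = 1+n≢n (sym a≡1+a)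
adj-irrefl (inj₂ a≡1+a) = 1+n≢n (sym a≡1+a)

adj-not-both-far-values : ∀ {x y a b} → Far x y → AdjValues a b → ¬ (OneOf x y a × OneOf x y b)
adj-not-both-far-values _ adj (inj₁ refl , inj₁ refl) = adj-irrefl adj
adj-not-both-far-values _ adj (inj₂ refl , inj₂ refl) = adj-irrefl adj
adj-not-both-far-values (_ , ¬adj) adj (inj₁ refl , inj₂ refl) = ¬adj adj
adj-not-both-far-values (_ , ¬adj) adj (inj₂ refl , inj₁ refl) = ¬adj (Sum.swap adj)

step⇒restrict≡ : ∀ {x y u v} → Far x y → Step u v → restrict x y u ≡ restrict x y v
step⇒restrict≡ {x} {y} f (swap xs ys a b adj) = begin
  restrict x y (xs ++ a ∷ b ∷ ys)
    ≡⟨ filter-++ (oneOf? x y) xs _ ⟩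
  restrict x y xs ++ restrict x y (a ∷ b ∷ ys)
    ≡⟨ cong (restrict x y xs ++_) (filter-swap (oneOf? x y) ys (adj-not-both-far-values f adj)) ⟩
  restrict x y xs ++ restrict x y (b ∷ a ∷ ys)
    ≡⟨ filter-++ (oneOf? x y) xs _ ⟨
  restrict x y (xs ++ b ∷ a ∷ ys) ∎
  where open ≡-Reasoning

∼⇒agree : ∀ {u v} → u ∼ v → Agree u v
∼⇒agree ε          x y f = refl
∼⇒agree (st ◅ sts) x y f = trans (step⇒restrict≡ f st) (∼⇒agree sts x y f)

restrict-head-differs : ∀ {x y} ps {u v} → x ≢ y → All (¬_ ∘ OneOf x y) ps →
                        restrict x y (x ∷ u) ≢ restrict x y (ps ++ y ∷ v)
restrict-head-differs {x} {y} ps {u} {v} x≢y ¬ps eq =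
  x≢y (proj₁ (∷-injective (begin
    x ∷ restrict x y u                     ≡⟨ filter-accept (oneOf? x y) (inj₁ refl) ⟨
    restrict x y (x ∷ u)                   ≡⟨ eq ⟩
    restrict x y (ps ++ y ∷ v)             ≡⟨ filter-++ (oneOf? x y) ps _ ⟩
    restrict x y ps ++ restrict x y (y ∷ v)
      ≡⟨ cong₂ _++_ (filter-none (oneOf? x y) ¬ps) (filter-accept (oneOf? x y) (inj₂ refl)) ⟩
    y ∷ restrict x y v                     ∎)))
  where open ≡-Reasoning

data Closeness : ℕ → ℕ → Set where
  equal : ∀ {x}   → Closeness x x
  above : ∀ {y}   → Closeness (suc y) y
  below : ∀ {x}   → Closeness x (suc x)
  far   : ∀ {x y} → Far x y → Closeness x y

closeness : ∀ x y → Closeness x y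
closeness x y with x ≟ y
... | yes refl = equal
... | no x≢y with x ≟ suc y
...   | yes refl = above
...   | no x≢1+y with y ≟ suc x
...     | yes refl = below
...     | no y≢1+x = far (x≢y , [ x≢1+y , y≢1+x ])

hook-head-¬agree : ∀ {c u v} → Unique (suc (suc c) ∷ c ∷ u) → suc c ∈ u →
                   ¬ Redex (suc (suc c) ∷ c ∷ u) →
                   ¬ Agree (suc (suc c) ∷ c ∷ u) (suc c ∷ v)
hook-head-¬agree {c} {d ∷ u} ((_ ∷ c+2≢d ∷ _) ∷ (c≢d ∷ _) ∷ _) _ ¬r ag
  with closeness (suc c) d
... | equal = ¬r hook
... | above = c≢d refl
... | below = c+2≢d refl
... | far f@(c+1≢d , _) =
  restrict-head-differs (suc (suc c) ∷ c ∷ []) c+1≢d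
    ([ 1+n≢n , c+2≢d ] ∷ [ 1+n≢n ∘ sym , c≢d ] ∷ [])
    (sym (ag (suc c) d f))

-- k occurs after the leading k+1, and the entry c right after k+1 is k (a descent),
-- k−1 (handled by hook-head-¬agree) or far from k, in which case c precedes k on
-- the left but not on the right.
succ-head-¬agree : ∀ {k u v} → Unique (suc k ∷ u) → k ∈ u → ¬ Redex (suc k ∷ u) →
                   ¬ Agree (suc k ∷ u) (k ∷ v)
succ-head-¬agree {k} {c ∷ u} us@((k+1≢c ∷ _) ∷ _) k∈ ¬r ag with closeness k c
... | equal = ¬r descent
... | above = hook-head-¬agree us (Any.tail 1+n≢n k∈) ¬r ag
... | below = k+1≢c refl
... | far f@(k≢c , _) =
  restrict-head-differs (suc k ∷ []) k≢c ([ 1+n≢n , k+1≢c ] ∷ []) (sym (ag k c f))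

irreducible-agree⇒≡ : ∀ {u v} → Unique u → Unique v → u ↭ v → Agree u v →
                      ¬ Redex u → ¬ Redex v → u ≡ v
irreducible-agree⇒≡ {[]}    {[]}    _ _ _ _ _ _ = refl
irreducible-agree⇒≡ {[]}    {_ ∷ _} _ _ p _ _ _ = ⊥-elim (¬x∷xs↭[] (↭-sym p))
irreducible-agree⇒≡ {_ ∷ _} {[]}    _ _ p _ _ _ = ⊥-elim (¬x∷xs↭[] p)
irreducible-agree⇒≡ {m ∷ u} {m′ ∷ v} us vs p ag ¬ru ¬rv with closeness m m′
... | equal =
  cong (m ∷_) (irreducible-agree⇒≡ (AllPairs.tail us) (AllPairs.tail vs) (drop-∷ p)
                 (agree-∷-cancel {m} {u} {v} ag) (¬ru ∘ later) (¬rv ∘ later))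
... | above = ⊥-elim (succ-head-¬agree us (Any.tail (1+n≢n ∘ sym) (∈-resp-↭ (↭-sym p) (here refl)))
                                       ¬ru ag)
... | below = ⊥-elim (succ-head-¬agree vs (Any.tail (1+n≢n ∘ sym) (∈-resp-↭ p (here refl)))
                                       ¬rv (agree-sym {m ∷ u} {m′ ∷ v} ag))
... | far f@(m≢m′ , _) = ⊥-elim (restrict-head-differs [] m≢m′ [] (ag m m′ f))

unique-oneToN : ∀ n → Unique (oneToN n)
unique-oneToN n = Unique.map⁺ suc-injective (Unique.upTo⁺ n)

lemma2p1 : (n : ℕ) → n ≥ 1 → (w : List ℕ) → IsPerm n w →
    (∃ λ (s : List ℕ) → IsPerm n s × Salient s × (w ∼ s))
    × ((s t : List ℕ) → IsPerm n s → IsPerm n t → Salient s → Salient t →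
       w ∼ s → w ∼ t → s ≡ t)
lemma2p1 n _ w w↭ with normalise w (<-wellFounded (potential w))
... | s , w∼s , ¬rs = (s , ↭-trans (↭-sym (∼⇒↭ w∼s)) w↭ , ¬redex⇒salient ¬rs , w∼s) , unique
  where
  perm-unique : ∀ {v} → IsPerm n v → Unique v
  perm-unique v↭ = Unique-resp-↭ (↭⇒↭ₛ (↭-sym v↭)) (unique-oneToN n)

  unique : (u v : List ℕ) → IsPerm n u → IsPerm n v → Salient u → Salient v →
           w ∼ u → w ∼ v → u ≡ v
  unique u v u↭ v↭ su sv w∼u w∼v =
    irreducible-agree⇒≡ (perm-unique u↭) (perm-unique v↭) (↭-trans u↭ (↭-sym v↭))
      (agree-trans {u} {w} {v} (agree-sym {w} {u} (∼⇒agree w∼u)) (∼⇒agree w∼v))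
      (salient⇒¬redex su) (salient⇒¬redex sv)
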